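{- Let $G$ be a finite group, $L$ its Cayley table $L(x,y)=xy$, and for $1\le i\le t$ let $K_i(x,y)=x\mu_i(y)$ where each $\mu_i\colon G\to G$ is a group automorphism, such that $(L,K_1,\dots,K_t)$ is a set of mutually orthogonal Latin squares. Then this set of MOLS is simply transitive.
   Context: The set of MOLS is identified with the orthogonal array $S=\{(x,y,xy,x\mu_1(y),\dots,x\mu_t(y)):x,y\in G\}\subset G^{t+3}$. Its autotopy group is the group of tuples $(\sigma_1,\dots,\sigma_{t+3})$ of bijections of $G$ whose coordinatewise action maps $S$ onto $S$. The set of MOLS is simply transitive if some subgroup of its autotopy group acts simply transitively on $S$. -}

module Defs where

open import Data.Nat using (ℕ; suc; _+_)
open import Data.Fin using (Fin; zero; suc)
open import Data.Product using (Σ; ∃; ∃-syntax; _×_; _,_)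
open import Relation.Binary.PropositionalEquality using (_≡_)
open import Relation.Nullary using (¬_)
open import Function.Bundles using (_↔_)
open import Function.Definitions using (Bijective)
open import Algebra.Structures using (IsGroup)

record FiniteGroup : Set₁ where
  field
    Carrier : Set
    _∙_     : Carrier → Carrier → Carrier
    ε       : Carrier
    _⁻¹     : Carrier → Carrier
    isGroup : IsGroup (_≡_ {A = Carrier}) _∙_ ε _⁻¹
    size    : ℕ
    finite  : Carrier ↔ Fin size

module _ (G : FiniteGroup) where
  open FiniteGroup G renaming (Carrier to A)

  IsAutomorphism : (A → A) → Set
  IsAutomorphism μ = Bijective _≡_ _≡_ μ × (∀ x y → μ (x ∙ y) ≡ μ x ∙ μ y)

  cayley : A → A → A
  cayley x y = x ∙ y

  twisted : (A → A) → A → A → A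
  twisted μ x y = x ∙ μ y

  IsLatin : (A → A → A) → Set
  IsLatin f = (∀ x → Bijective _≡_ _≡_ (λ y → f x y))
            × (∀ y → Bijective _≡_ _≡_ (λ x → f x y))

  Orthogonal : (A → A → A) → (A → A → A) → Set
  Orthogonal f g = Bijective _≡_ _≡_ (λ (p : A × A) → let (x , y) = p in (f x y , g x y))

  IsMOLS : {m : ℕ} → (Fin m → A → A → A) → Set
  IsMOLS {m} sq = (∀ i → IsLatin (sq i))
                × (∀ i j → ¬ (i ≡ j) → Orthogonal (sq i) (sq j))

  squares : {t : ℕ} → (Fin t → A → A) → Fin (suc t) → A → A → A
  squares μ zero    = cayley
  squares μ (suc i) = twisted (μ i)

  Tuple : ℕ → Set
  Tuple t = Fin (3 + t) → A

  row : {t : ℕ} → (Fin t → A → A) → A → A → Tuple t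
  row μ x y zero          = x
  row μ x y (suc zero)    = y
  row μ x y (suc (suc i)) = squares μ i x y

  _≋_ : {t : ℕ} → Tuple t → Tuple t → Set
  v ≋ w = ∀ k → v k ≡ w k

  InS : {t : ℕ} → (Fin t → A → A) → Tuple t → Set
  InS μ v = ∃[ x ] ∃[ y ] (v ≋ row μ x y)

  Map : ℕ → Set
  Map t = Fin (3 + t) → A → A

  act : {t : ℕ} → Map t → Tuple t → Tuple t
  act σ v k = σ k (v k)

  IsAutotopy : {t : ℕ} → (Fin t → A → A) → Map t → Set
  IsAutotopy μ σ = (∀ k → Bijective _≡_ _≡_ (σ k))
                 × (∀ v → InS μ v → InS μ (act σ v))
                 × (∀ w → InS μ w → ∃[ v ] (InS μ v × act σ v ≋ w))

  idMap : {t : ℕ} → Map t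
  idMap k a = a

  _∘ₘ_ : {t : ℕ} → Map t → Map t → Map t
  (σ ∘ₘ τ) k a = σ k (τ k a)

  _≐_ : {t : ℕ} → Map t → Map t → Set
  σ ≐ τ = ∀ k a → σ k a ≡ τ k a

  IsAutotopySubgroup : {t : ℕ} → (Fin t → A → A) → (Map t → Set) → Set
  IsAutotopySubgroup μ H =
      (∀ σ → H σ → IsAutotopy μ σ)
    × (∀ σ τ → σ ≐ τ → H σ → H τ)
    × H idMap
    × (∀ σ τ → H σ → H τ → H (σ ∘ₘ τ))
    × (∀ σ → H σ → ∃[ τ ] (H τ × (τ ∘ₘ σ) ≐ idMap × (σ ∘ₘ τ) ≐ idMap))

  ActsSimplyTransitively : {t : ℕ} → (Fin t → A → A) → (Map t → Set) → Set
  ActsSimplyTransitively μ H =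
      (∀ v w → InS μ v → InS μ w → ∃[ σ ] (H σ × act σ v ≋ w))
    × (∀ v σ τ → InS μ v → H σ → H τ → act σ v ≋ act τ v → σ ≐ τ)

  IsSimplyTransitive : {t : ℕ} → (Fin t → A → A) → Set₁
  IsSimplyTransitive μ = ∃[ H ] (IsAutotopySubgroup μ H × ActsSimplyTransitively μ H)

{-# OPTIONS --safe #-}
-- G × G acts on S by autotopies: (a, b) acts by z ↦ a z on the row coordinate, z ↦ z b on
-- the column coordinate, and z ↦ a z ν(b) on the coordinate of a square x ν(y) (ν = id for L,
-- μᵢ for Kᵢ). Since ν is a homomorphism, this sends the row of (x, y) to the row of (a x, y b),
-- so on the index pairs of S it is the regular action of G × G, hence simply transitive.
module Submission where

open import Defs hiding (_≋_; _≐_; _∘ₘ_)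
import Defs
open import Data.Nat using (ℕ; suc)
open import Data.Fin using (Fin; zero; suc)
open import Data.Product using (∃-syntax; _×_; _,_; proj₁; proj₂)
open import Function.Definitions using (Bijective)
open import Function.Consequences.Propositional
  using (inverseᵇ⇒bijective; strictlyInverseˡ⇒inverseˡ; strictlyInverseʳ⇒inverseʳ)
open import Relation.Binary.PropositionalEquality
  using (_≡_; refl; sym; trans; cong; cong₂; module ≡-Reasoning)
open import Algebra.Bundles using (Group)
import Algebra.Properties.Group as GroupProperties
import Algebra.Properties.Semigroup as SemigroupProperties

module _ (G : FiniteGroup) where
  open FiniteGroup G renaming (Carrier to A)

  private
    infix 4 _≋_ _≐_
    infixr 9 _∘ₘ_

    _≋_ : ∀ {t} → Tuple G t → Tuple G t → Set
    _≋_ = Defs._≋_ G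

    _≐_ : ∀ {t} → Map G t → Map G t → Set
    _≐_ = Defs._≐_ G

    _∘ₘ_ : ∀ {t} → Map G t → Map G t → Map G t
    _∘ₘ_ = Defs._∘ₘ_ G

    group : Group _ _
    group = record { isGroup = isGroup }

  open Group group using (assoc; identityˡ; identityʳ; inverseˡ; inverseʳ; _\\_; _//_; semigroup)
  open GroupProperties group
    using (∙-cancelˡ; ∙-cancelʳ; identityʳ-unique; \\-leftDividesˡ; //-rightDividesˡ)
  open SemigroupProperties semigroup using ([u∙vw]x≈uv∙wx)

  IsHomomorphism : (A → A) → Set
  IsHomomorphism φ = ∀ x y → φ (x ∙ y) ≡ φ x ∙ φ y

  homomorphism-ε : ∀ {φ} → IsHomomorphism φ → φ ε ≡ ε
  homomorphism-ε {φ} homo = identityʳ-unique (φ ε) (φ ε) (begin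
    φ ε ∙ φ ε  ≡⟨ homo ε ε ⟨
    φ (ε ∙ ε)  ≡⟨ cong φ (identityˡ ε) ⟩
    φ ε        ∎)
    where open ≡-Reasoning

  ≐-refl : ∀ {t} {σ : Map G t} → σ ≐ σ
  ≐-refl k z = refl

  ≐-sym : ∀ {t} {σ τ : Map G t} → σ ≐ τ → τ ≐ σ
  ≐-sym p k z = sym (p k z)

  ≐-trans : ∀ {t} {σ τ υ : Map G t} → σ ≐ τ → τ ≐ υ → σ ≐ υ
  ≐-trans p q k z = trans (p k z) (q k z)

  ∘ₘ-cong : ∀ {t} {σ σ′ τ τ′ : Map G t} → σ ≐ σ′ → τ ≐ τ′ → σ ∘ₘ τ ≐ σ′ ∘ₘ τ′
  ∘ₘ-cong {σ = σ} p q k z = trans (cong (σ k) (q k z)) (p k _)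

  act-cong : ∀ {t} {σ τ : Map G t} {v w : Tuple G t} → σ ≐ τ → v ≋ w → act G σ v ≋ act G τ w
  act-cong {σ = σ} p q k = trans (cong (σ k) (q k)) (p k _)

  act-congʳ : ∀ {t} (σ : Map G t) {v w : Tuple G t} → v ≋ w → act G σ v ≋ act G σ w
  act-congʳ σ q k = cong (σ k) (q k)

  row-cong : ∀ {t} (μ : Fin t → A → A) {x x′ y y′} → x ≡ x′ → y ≡ y′ → row G μ x y ≋ row G μ x′ y′
  row-cong μ refl refl k = refl

  InS-resp-≋ : ∀ {t} {μ : Fin t → A → A} {v w} → v ≋ w → InS G μ v → InS G μ w
  InS-resp-≋ v≋w (x , y , v≋row) = x , y , λ k → trans (sym (v≋w k)) (v≋row k)

  IsAutotopy-resp-≐ : ∀ {t} {μ : Fin t → A → A} {σ τ : Map G t} →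
                      σ ≐ τ → IsAutotopy G μ τ → IsAutotopy G μ σ
  IsAutotopy-resp-≐ {μ = μ} {σ} {τ} σ≐τ (τ-bijective , τ-into , τ-onto) = bijective , into , onto
    where
    bijective : ∀ k → Bijective _≡_ _≡_ (σ k)
    bijective k = injective , surjective
      where
      injective : ∀ {x y} → σ k x ≡ σ k y → x ≡ y
      injective {x} {y} p = proj₁ (τ-bijective k) (trans (sym (σ≐τ k x)) (trans p (σ≐τ k y)))
      surjective : ∀ y → ∃[ x ] (∀ {z} → z ≡ x → σ k z ≡ y)
      surjective y with proj₂ (τ-bijective k) y
      ... | x , τx≡y = x , λ z≡x → trans (σ≐τ k _) (τx≡y z≡x)
    into : ∀ v → InS G μ v → InS G μ (act G σ v)
    into v v∈S = InS-resp-≋ (λ k → sym (σ≐τ k (v k))) (τ-into v v∈S)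
    onto : ∀ w → InS G μ w → ∃[ v ] (InS G μ v × act G σ v ≋ w)
    onto w w∈S with τ-onto w w∈S
    ... | v , v∈S , τv≋w = v , v∈S , λ k → trans (σ≐τ k (v k)) (τv≋w k)

  module Translations {t : ℕ} (μ : Fin t → A → A) (μ-homo : ∀ i → IsHomomorphism (μ i)) where

    ν : Fin (suc t) → A → A
    ν zero    z = z
    ν (suc i) = μ i

    ν-homo : ∀ k → IsHomomorphism (ν k)
    ν-homo zero    x y = refl
    ν-homo (suc i) = μ-homo i

    squares-ν : ∀ k x y → squares G μ k x y ≡ x ∙ ν k y
    squares-ν zero    x y = refl
    squares-ν (suc i) x y = refl

    translation : A → A → Map G t
    translation a b zero          z = a ∙ z
    translation a b (suc zero)    z = z ∙ b
    translation a b (suc (suc k)) z = (a ∙ z) ∙ ν k b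

    translation-row : ∀ a b x y → act G (translation a b) (row G μ x y) ≋ row G μ (a ∙ x) (y ∙ b)
    translation-row a b x y zero          = refl
    translation-row a b x y (suc zero)    = refl
    translation-row a b x y (suc (suc k)) = begin
      (a ∙ squares G μ k x y) ∙ ν k b  ≡⟨ cong (λ u → (a ∙ u) ∙ ν k b) (squares-ν k x y) ⟩
      (a ∙ (x ∙ ν k y)) ∙ ν k b        ≡⟨ [u∙vw]x≈uv∙wx a x (ν k y) (ν k b) ⟩
      (a ∙ x) ∙ (ν k y ∙ ν k b)        ≡⟨ cong ((a ∙ x) ∙_) (ν-homo k y b) ⟨
      (a ∙ x) ∙ ν k (y ∙ b)            ≡⟨ squares-ν k (a ∙ x) (y ∙ b) ⟨
      squares G μ k (a ∙ x) (y ∙ b)    ∎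
      where open ≡-Reasoning

    translation-∘ : ∀ a b c d → translation a b ∘ₘ translation c d ≐ translation (a ∙ c) (d ∙ b)
    translation-∘ a b c d zero          z = sym (assoc a c z)
    translation-∘ a b c d (suc zero)    z = assoc z d b
    translation-∘ a b c d (suc (suc k)) z = begin
      (a ∙ ((c ∙ z) ∙ ν k d)) ∙ ν k b  ≡⟨ [u∙vw]x≈uv∙wx a (c ∙ z) (ν k d) (ν k b) ⟩
      (a ∙ (c ∙ z)) ∙ (ν k d ∙ ν k b)  ≡⟨ cong₂ _∙_ (sym (assoc a c z)) (sym (ν-homo k d b)) ⟩
      ((a ∙ c) ∙ z) ∙ ν k (d ∙ b)      ∎
      where open ≡-Reasoning

    translation-ε : translation ε ε ≐ idMap G
    translation-ε zero          z = identityˡ z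
    translation-ε (suc zero)    z = identityʳ z
    translation-ε (suc (suc k)) z = begin
      (ε ∙ z) ∙ ν k ε  ≡⟨ cong₂ _∙_ (identityˡ z) (homomorphism-ε (ν-homo k)) ⟩
      z ∙ ε            ≡⟨ identityʳ z ⟩
      z                ∎
      where open ≡-Reasoning

    translation-cong : ∀ {a a′ b b′} → a ≡ a′ → b ≡ b′ → translation a b ≐ translation a′ b′
    translation-cong refl refl k z = refl

    translation-inverseˡ : ∀ a b → translation (a ⁻¹) (b ⁻¹) ∘ₘ translation a b ≐ idMap G
    translation-inverseˡ a b = ≐-trans (translation-∘ (a ⁻¹) (b ⁻¹) a b)
      (≐-trans (translation-cong (inverseˡ a) (inverseʳ b)) translation-ε)

    translation-inverseʳ : ∀ a b → translation a b ∘ₘ translation (a ⁻¹) (b ⁻¹) ≐ idMap G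
    translation-inverseʳ a b = ≐-trans (translation-∘ a b (a ⁻¹) (b ⁻¹))
      (≐-trans (translation-cong (inverseʳ a) (inverseˡ b)) translation-ε)

    translation-bijective : ∀ a b k → Bijective _≡_ _≡_ (translation a b k)
    translation-bijective a b k = inverseᵇ⇒bijective
      ( strictlyInverseˡ⇒inverseˡ (translation a b k) (translation-inverseʳ a b k)
      , strictlyInverseʳ⇒inverseʳ (translation a b k) (translation-inverseˡ a b k))

    translation-into : ∀ a b v → InS G μ v → InS G μ (act G (translation a b) v)
    translation-into a b v (x , y , v≋row) =
      a ∙ x , y ∙ b , λ k → trans (act-congʳ (translation a b) v≋row k) (translation-row a b x y k)

    translation-isAutotopy : ∀ a b → IsAutotopy G μ (translation a b)
    translation-isAutotopy a b = translation-bijective a b , translation-into a b , onto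
      where
      onto : ∀ w → InS G μ w → ∃[ v ] (InS G μ v × act G (translation a b) v ≋ w)
      onto w w∈S = act G (translation (a ⁻¹) (b ⁻¹)) w
                 , translation-into (a ⁻¹) (b ⁻¹) w w∈S
                 , λ k → translation-inverseʳ a b k (w k)

    translation-row-onto : ∀ x y x′ y′ →
                           act G (translation (x′ // x) (y \\ y′)) (row G μ x y) ≋ row G μ x′ y′
    translation-row-onto x y x′ y′ k = trans (translation-row (x′ // x) (y \\ y′) x y k)
      (row-cong μ (//-rightDividesˡ x x′) (\\-leftDividesˡ y y′) k)

    translation-row-injective : ∀ {a b c d} x y →
      act G (translation a b) (row G μ x y) ≋ act G (translation c d) (row G μ x y) → a ≡ c × b ≡ d
    translation-row-injective {a} {b} {c} {d} x y p =
      ∙-cancelʳ x a c (p zero) , ∙-cancelˡ y b d (p (suc zero))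

    IsTranslation : Map G t → Set
    IsTranslation σ = ∃[ a ] ∃[ b ] σ ≐ translation a b

    translations-isAutotopySubgroup : IsAutotopySubgroup G μ IsTranslation
    translations-isAutotopySubgroup = isAutotopy , resp-≐ , identity , closed-∘ , closed-inverse
      where
      isAutotopy : ∀ σ → IsTranslation σ → IsAutotopy G μ σ
      isAutotopy σ (a , b , σ≐T) = IsAutotopy-resp-≐ σ≐T (translation-isAutotopy a b)

      resp-≐ : ∀ σ τ → σ ≐ τ → IsTranslation σ → IsTranslation τ
      resp-≐ σ τ σ≐τ (a , b , σ≐T) = a , b , ≐-trans (≐-sym σ≐τ) σ≐T

      identity : IsTranslation (idMap G)
      identity = ε , ε , ≐-sym translation-ε

      closed-∘ : ∀ σ τ → IsTranslation σ → IsTranslation τ → IsTranslation (σ ∘ₘ τ)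
      closed-∘ σ τ (a , b , σ≐T) (c , d , τ≐T) =
        a ∙ c , d ∙ b , ≐-trans (∘ₘ-cong σ≐T τ≐T) (translation-∘ a b c d)

      closed-inverse : ∀ σ → IsTranslation σ →
        ∃[ τ ] (IsTranslation τ × τ ∘ₘ σ ≐ idMap G × σ ∘ₘ τ ≐ idMap G)
      closed-inverse σ (a , b , σ≐T) =
          σ⁻¹ , (a ⁻¹ , b ⁻¹ , ≐-refl)
        , ≐-trans (∘ₘ-cong (≐-refl {σ = σ⁻¹}) σ≐T) (translation-inverseˡ a b)
        , ≐-trans (∘ₘ-cong σ≐T (≐-refl {σ = σ⁻¹})) (translation-inverseʳ a b)
        where
        σ⁻¹ : Map G t
        σ⁻¹ = translation (a ⁻¹) (b ⁻¹)

    translations-actSimplyTransitively : ActsSimplyTransitively G μ IsTranslation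
    translations-actSimplyTransitively = transitive , free
      where
      transitive : ∀ v w → InS G μ v → InS G μ w → ∃[ σ ] (IsTranslation σ × act G σ v ≋ w)
      transitive v w (x , y , v≋row) (x′ , y′ , w≋row) =
        σ , (_ , _ , ≐-refl) ,
        λ k → trans (act-congʳ σ v≋row k) (trans (translation-row-onto x y x′ y′ k) (sym (w≋row k)))
        where
        σ : Map G t
        σ = translation (x′ // x) (y \\ y′)

      free : ∀ v σ τ → InS G μ v → IsTranslation σ → IsTranslation τ →
             act G σ v ≋ act G τ v → σ ≐ τ
      free v σ τ (x , y , v≋row) (a , b , σ≐T) (c , d , τ≐T) σv≋τv
        with translation-row-injective x y (λ k →
               trans (act-cong (≐-sym σ≐T) (λ k → sym (v≋row k)) k)
                     (trans (σv≋τv k) (act-cong τ≐T v≋row k)))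
      ... | refl , refl = ≐-trans σ≐T (≐-sym τ≐T)

corollary5p6 : (G : FiniteGroup) → (t : ℕ)
    → (μ : Fin t → FiniteGroup.Carrier G → FiniteGroup.Carrier G)
    → (∀ i → IsAutomorphism G (μ i))
    → IsMOLS G (squares G μ)
    → IsSimplyTransitive G μ
corollary5p6 G t μ μ-automorphism _ =
  IsTranslation , translations-isAutotopySubgroup , translations-actSimplyTransitively
  where open Translations G μ (λ i → proj₂ (μ-automorphism i))
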